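{- Let $f(z)$ be a vertex of the tree $\mathcal{T}(z)$. Then there is exactly one choice of $k\in\mathbb{N}_0$, $q_0\in\mathbb{N}_0$ and positive integers $q_1,\dots,q_k$ such that one of the following holds: - $k$ is even and $f(z)=[q_0,q_1,\dots,q_{k-1},q_k+z]$; - $k$ is odd and $f(z)=[q_0,q_1,\dots,q_k,z]$. Only one of the two forms can occur. Moreover, $f(z)$ lies in row $q_0+q_1+\cdots+q_k$ of $\mathcal{T}(z)$.
   Context: Let $z$ be a variable. A positive linear fractional transformation is an expression $w=\frac{az+b}{cz+d}$ with $a,b,c,d\in\mathbb{N}_0=\{0,1,2,\dots\}$ and $ad-bc\neq0$. Its left child is $\frac{w}{w+1}:=\frac{az+b}{(a+c)z+(b+d)}$ and its right child is $w+1:=\frac{(a+c)z+(b+d)}{cz+d}$. Row $0$ of $\mathcal{T}(z)$ is $(z)$. For $n\ge1$, row $n$ consists of the $2^n$ children (left child, then right child) of the entries of row $n-1$, taken in order. The vertices of $\mathcal{T}(z)$ are the entries of all rows. Continued fraction notation: - $[x]=x$; - $[q_0,x_1,\dots,x_m]=q_0+\dfrac{1}{[x_1,\dots,x_m]}$; - $[q_0,\dots,q_{k-1},q_k+z]=q_0+\cfrac{1}{q_1+\cfrac{1}{\ddots+\cfrac{1}{q_k+z}}}$; - $[q_0,\dots,q_k,z]=q_0+\cfrac{1}{q_1+\cfrac{1}{\ddots+\cfrac{1}{q_k+\frac1z}}}$. For $k=0$ the first form is $q_0+z$. Equalities are identities of rational functions in $z$. -}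

module Defs where

open import Data.Nat using (ℕ; zero; suc; _+_; _*_)
open import Data.List using (List; []; _∷_; _++_; concatMap)
open import Data.Product using (_×_)
open import Relation.Binary.PropositionalEquality using (_≡_)

-- A linear fractional transformation (a z + b) / (c z + d), a b c d ∈ ℕ₀.
record LFT : Set where
  constructor lft
  field
    a b c d : ℕ
open LFT public

idZ : LFT
idZ = lft 1 0 0 1

-- left child  w / (w + 1)
leftChild : LFT → LFT
leftChild (lft a b c d) = lft a b (a + c) (b + d)

-- right child  w + 1
rightChild : LFT → LFT
rightChild (lft a b c d) = lft (a + c) (b + d) c d

row : ℕ → List LFT
row zero    = idZ ∷ []
row (suc n) = concatMap (λ w → leftChild w ∷ rightChild w ∷ []) (row n)

addN : ℕ → LFT → LFT
addN q (lft a b c d) = lft (a + q * c) (b + q * d) c d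

recip : LFT → LFT
recip (lft a b c d) = lft c d a b

-- Equality as rational functions in z:
-- (a z + b)(c' z + d') = (a' z + b')(c z + d) as polynomials.
_≈_ : LFT → LFT → Set
lft a b c d ≈ lft a' b' c' d' =
  (a * c' ≡ a' * c) × (a * d' + b * c' ≡ a' * d + b' * c) × (b * d' ≡ b' * d)

-- cfPlusZ q0 (q1 ∷ … ∷ qk ∷ []) = [q0, q1, …, q_{k-1}, q_k + z]
cfPlusZ : ℕ → List ℕ → LFT
cfPlusZ q []        = addN q idZ
cfPlusZ q (q' ∷ qs) = addN q (recip (cfPlusZ q' qs))

-- cfRecZ q0 (q1 ∷ … ∷ qk ∷ []) = [q0, q1, …, q_k, z]
cfRecZ : ℕ → List ℕ → LFT
cfRecZ q []        = addN q (recip idZ)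
cfRecZ q (q' ∷ qs) = addN q (recip (cfRecZ q' qs))

module Submission where

-- Every vertex of T(z) is obtained from z by a word of moves
-- L (left child, w ↦ w/(w+1)) and R (right child, w ↦ w+1), and row n consists
-- exactly of the values of the words of length n.  Cutting a word into maximal
-- runs R^q₀ L^q₁ R^q₂ … (q₀ ≥ 0, all later runs nonempty) is a bijection between
-- words and pairs (q₀, positive q₁ … q_k), and the word has length q₀ + … + q_k.
-- Since R^q w = q + w and L^q w = 1/(q + 1/w), the word with runs q₀, …, q_k
-- evaluates to [q₀, …, q_k + z] when k is even and to [q₀, …, q_k, z] when k is
-- odd.  Finally, distinct words give distinct rational functions: all vertices
-- have determinant ad − bc = 1, so z is not a child, a left child is never a
-- right child, and a child determines its parent.  Existence and the row follow
-- by encoding the word of the vertex; uniqueness follows because any admissible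
-- (q₀, q₁ … q_k) is the encoding of a word with the same value, hence of the
-- vertex's own word.

open import Defs
open import Data.Nat using (ℕ; zero; suc; s≤s; z≤n; _+_; _*_; _≤_; _%_)
open import Data.Nat.Properties
  using (+-comm; +-cancelˡ-≡; +-cancelʳ-≡; +-identityʳ; *-zeroʳ; *-identityʳ; 0≢1+n; m+n≡0⇒m≡0; m+n≡0⇒n≡0; m*n≡0⇒m≡0∨n≡0)
open import Data.Nat.Tactic.RingSolver using (solve)
open import Data.Nat.ListAction using (sum)
open import Data.Bool using (Bool; true; false; not; if_then_else_)
open import Data.Bool.Properties using (not-involutive)
open import Data.List using (List; []; _∷_; length)
open import Data.List.Relation.Unary.All using (All)
import Data.List.Relation.Unary.All as All
open import Data.List.Relation.Unary.Any using (here; there)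
import Data.List.Relation.Unary.Any as Any
open import Data.List.Membership.Propositional using (_∈_; find)
open import Data.List.Membership.Propositional.Properties using (∈-concatMap⁺; ∈-concatMap⁻)
open import Data.Product using (_×_; ∃-syntax; _,_; proj₁; proj₂; uncurry)
open import Data.Sum using (_⊎_; inj₁; inj₂)
open import Data.Empty using (⊥-elim)
open import Relation.Nullary using (¬_)
open import Relation.Binary.PropositionalEquality
  using (_≡_; _≢_; refl; sym; trans; cong; cong₂; subst; module ≡-Reasoning)
open ≡-Reasoning

data Move : Set where
  L R : Move

switch : Move → Move
switch L = R
switch R = L

move : Move → LFT → LFT
move L = leftChild
move R = rightChild

-- The vertex reached from z by a word; the first letter is the last move made.
eval : List Move → LFT
eval []      = idZ
eval (m ∷ w) = move m (eval w)

children : LFT → List LFT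
children M = leftChild M ∷ rightChild M ∷ []

move∈row : ∀ n {M} m → M ∈ row n → move m M ∈ row (suc n)
move∈row n m M∈row = ∈-concatMap⁺ children (Any.map (λ { refl → child∈ m }) M∈row)
  where
  child∈ : ∀ {M} m → move m M ∈ children M
  child∈ L = here refl
  child∈ R = there (here refl)

row-suc⁻ : ∀ n {N} → N ∈ row (suc n) → ∃[ M ] ∃[ m ] (M ∈ row n × N ≡ move m M)
row-suc⁻ n N∈row with find (∈-concatMap⁻ children {xs = row n} N∈row)
... | M , M∈row , here N≡L         = M , L , M∈row , N≡L
... | M , M∈row , there (here N≡R) = M , R , M∈row , N≡R

eval∈row : ∀ w → eval w ∈ row (length w)
eval∈row []      = here refl
eval∈row (m ∷ w) = move∈row (length w) m (eval∈row w)

row-words : ∀ n {f} → f ∈ row n → ∃[ w ] (length w ≡ n × f ≡ eval w)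
row-words zero    (here refl) = [] , refl , refl
row-words (suc n) f∈row with row-suc⁻ n f∈row
... | M , m , M∈row , refl with row-words n M∈row
...   | w , refl , refl = m ∷ w , refl , refl

Positive : List ℕ → Set
Positive = All (λ q → 1 ≤ q)

-- runs m q₀ (q₁ ∷ … ∷ q_k) = m^q₀ m'^q₁ m^q₂ …, alternating m and m' = switch m.
runs : Move → ℕ → List ℕ → List Move
runs m (suc q) qs       = m ∷ runs m q qs
runs m zero    []       = []
runs m zero    (q ∷ qs) = runs (switch m) q qs

extendRun : ℕ × List ℕ → ℕ × List ℕ
extendRun (q , qs) = suc q , qs

closeRun : ℕ × List ℕ → ℕ × List ℕ
closeRun (q , qs) = 0 , suc q ∷ qs

-- rle m w: the run lengths of w, the first (possibly empty) run consisting of m.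
rle : Move → List Move → ℕ × List ℕ
rle m []      = 0 , []
rle L (L ∷ w) = extendRun (rle L w)
rle L (R ∷ w) = closeRun (rle R w)
rle R (R ∷ w) = extendRun (rle R w)
rle R (L ∷ w) = closeRun (rle L w)

runs-rle : ∀ m w → uncurry (runs m) (rle m w) ≡ w
runs-rle m []      = refl
runs-rle L (L ∷ w) = cong (L ∷_) (runs-rle L w)
runs-rle L (R ∷ w) = cong (R ∷_) (runs-rle R w)
runs-rle R (R ∷ w) = cong (R ∷_) (runs-rle R w)
runs-rle R (L ∷ w) = cong (L ∷_) (runs-rle L w)

rle-runs : ∀ m q {qs} → Positive qs → rle m (runs m q qs) ≡ (q , qs)
rle-runs m zero    All.[]                    = refl
rle-runs L (suc q) pos                       = cong extendRun (rle-runs L q pos)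
rle-runs R (suc q) pos                       = cong extendRun (rle-runs R q pos)
rle-runs L zero    {suc q ∷ _} (_ All.∷ pos) = cong closeRun (rle-runs R q pos)
rle-runs R zero    {suc q ∷ _} (_ All.∷ pos) = cong closeRun (rle-runs L q pos)

rle-positive : ∀ m w → Positive (proj₂ (rle m w))
rle-positive m []      = All.[]
rle-positive L (L ∷ w) = rle-positive L w
rle-positive L (R ∷ w) = s≤s z≤n All.∷ rle-positive R w
rle-positive R (R ∷ w) = rle-positive R w
rle-positive R (L ∷ w) = s≤s z≤n All.∷ rle-positive L w

length-runs : ∀ m q qs → length (runs m q qs) ≡ q + sum qs
length-runs m (suc q) qs      = cong suc (length-runs m q qs)
length-runs m zero    []       = refl
length-runs m zero    (q ∷ qs) = length-runs (switch m) q qs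

addN-suc : ∀ q M → addN (suc q) M ≡ rightChild (addN q M)
addN-suc q (lft x y z t) = cong₂ (λ u v → lft u v z t) (shift x z) (shift y t)
  where
  shift : ∀ u v → u + (v + q * v) ≡ u + q * v + v
  shift u v = solve (u ∷ v ∷ q ∷ [])

addN-zero : ∀ M → addN 0 M ≡ M
addN-zero (lft x y z t) = cong₂ (λ u v → lft u v z t) (+-identityʳ x) (+-identityʳ y)

recip-involutive : ∀ M → recip (recip M) ≡ M
recip-involutive (lft x y z t) = refl

recip-rightChild : ∀ M → recip (rightChild M) ≡ leftChild (recip M)
recip-rightChild (lft x y z t) = cong₂ (λ u v → lft z t u v) (+-comm x z) (+-comm y t)

cf : Bool → ℕ → List ℕ → LFT
cf true  = cfPlusZ
cf false = cfRecZ

evenLength : List ℕ → Bool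
evenLength []       = true
evenLength (_ ∷ qs) = not (evenLength qs)

canonical : ℕ → List ℕ → LFT
canonical q qs = cf (evenLength qs) q qs

cf-suc : ∀ p q qs → cf p (suc q) qs ≡ rightChild (cf p q qs)
cf-suc true  q []       = addN-suc q idZ
cf-suc false q []       = addN-suc q (recip idZ)
cf-suc true  q (_ ∷ qs) = addN-suc q _
cf-suc false q (_ ∷ qs) = addN-suc q _

cf-zero : ∀ p q qs → cf p 0 (q ∷ qs) ≡ recip (cf p q qs)
cf-zero true  q qs = addN-zero _
cf-zero false q qs = addN-zero _

eval-runs-R : ∀ q qs → eval (runs R q qs) ≡ canonical q qs
eval-runs-L : ∀ q qs → eval (runs L q qs) ≡ recip (cf (not (evenLength qs)) q qs)

eval-runs-R zero    []       = refl
eval-runs-R (suc q) qs       = begin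
  rightChild (eval (runs R q qs))  ≡⟨ cong rightChild (eval-runs-R q qs) ⟩
  rightChild (canonical q qs)      ≡⟨ sym (cf-suc (evenLength qs) q qs) ⟩
  canonical (suc q) qs             ∎
eval-runs-R zero    (q ∷ qs) = trans (eval-runs-L q qs) (sym (cf-zero (evenLength (q ∷ qs)) q qs))

eval-runs-L zero    []       = refl
eval-runs-L (suc q) qs       = begin
  leftChild (eval (runs L q qs))   ≡⟨ cong leftChild (eval-runs-L q qs) ⟩
  leftChild (recip (cf p q qs))    ≡⟨ sym (recip-rightChild (cf p q qs)) ⟩
  recip (rightChild (cf p q qs))   ≡⟨ cong recip (sym (cf-suc p q qs)) ⟩
  recip (cf p (suc q) qs)          ∎
  where p = not (evenLength qs)
eval-runs-L zero    (q ∷ qs) = begin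
  eval (runs R q qs)               ≡⟨ eval-runs-R q qs ⟩
  cf p q qs                        ≡⟨ cong (λ p' → cf p' q qs) (sym (not-involutive p)) ⟩
  cf p″ q qs                       ≡⟨ sym (recip-involutive (cf p″ q qs)) ⟩
  recip (recip (cf p″ q qs))       ≡⟨ cong recip (sym (cf-zero p″ q qs)) ⟩
  recip (cf p″ 0 (q ∷ qs))         ∎
  where
  p  = evenLength qs
  p″ = not (not p)

-- Determinant one, ad = bc + 1: the invariant that keeps distinct words apart.
-- It forces a ≠ 0 and d ≠ 0.
Unimodular : LFT → Set
Unimodular M = a M * d M ≡ suc (b M * c M)

a≢0 : ∀ M → Unimodular M → a M ≢ 0
a≢0 (lft x y z t) u x≡0 = 0≢1+n (trans (sym (cong (_* t) x≡0)) u)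

d≢0 : ∀ M → Unimodular M → d M ≢ 0
d≢0 (lft x y z t) u t≡0 = 0≢1+n (trans (sym (trans (cong (x *_) t≡0) (*-zeroʳ x))) u)

leftChild-unimodular : ∀ M → Unimodular M → Unimodular (leftChild M)
leftChild-unimodular (lft x y z t) u = begin
  x * (y + t)           ≡⟨ solve (x ∷ y ∷ t ∷ []) ⟩
  x * t + x * y         ≡⟨ cong (_+ x * y) u ⟩
  suc (y * z + x * y)   ≡⟨ cong suc (solve (x ∷ y ∷ z ∷ [])) ⟩
  suc (y * (x + z))     ∎

rightChild-unimodular : ∀ M → Unimodular M → Unimodular (rightChild M)
rightChild-unimodular (lft x y z t) u = begin
  (x + z) * t           ≡⟨ solve (x ∷ z ∷ t ∷ []) ⟩
  x * t + z * t         ≡⟨ cong (_+ z * t) u ⟩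
  suc (y * z + z * t)   ≡⟨ cong suc (solve (y ∷ z ∷ t ∷ [])) ⟩
  suc ((y + t) * z)     ∎

eval-unimodular : ∀ w → Unimodular (eval w)
eval-unimodular []      = refl
eval-unimodular (L ∷ w) = leftChild-unimodular (eval w) (eval-unimodular w)
eval-unimodular (R ∷ w) = rightChild-unimodular (eval w) (eval-unimodular w)

≈-sym : ∀ M N → M ≈ N → N ≈ M
≈-sym (lft _ _ _ _) (lft _ _ _ _) (e₁ , e₂ , e₃) = sym e₁ , sym e₂ , sym e₃

rightChild-cancel : ∀ M N → rightChild M ≈ rightChild N → M ≈ N
rightChild-cancel (lft x y z t) (lft x' y' z' t') (e₁ , e₂ , e₃) =
  outer x z x' z' e₁ , middle , outer y t y' t' e₃
  where
  outer : ∀ x z x' z' → (x + z) * z' ≡ (x' + z') * z → x * z' ≡ x' * z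
  outer x z x' z' e = +-cancelʳ-≡ (z * z') (x * z') (x' * z) (begin
    x * z' + z * z'  ≡⟨ solve (x ∷ z ∷ z' ∷ []) ⟩
    (x + z) * z'     ≡⟨ e ⟩
    (x' + z') * z    ≡⟨ solve (x' ∷ z' ∷ z ∷ []) ⟩
    x' * z + z * z'  ∎)
  middle : x * t' + y * z' ≡ x' * t + y' * z
  middle = +-cancelʳ-≡ (z * t' + t * z') (x * t' + y * z') (x' * t + y' * z) (begin
    x * t' + y * z' + (z * t' + t * z')  ≡⟨ solve (x ∷ y ∷ z ∷ t ∷ z' ∷ t' ∷ []) ⟩
    (x + z) * t' + (y + t) * z'          ≡⟨ e₂ ⟩
    (x' + z') * t + (y' + t') * z        ≡⟨ solve (x' ∷ y' ∷ z' ∷ t' ∷ z ∷ t ∷ []) ⟩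
    x' * t + y' * z + (z * t' + t * z')  ∎)

leftChild-cancel : ∀ M N → leftChild M ≈ leftChild N → M ≈ N
leftChild-cancel (lft x y z t) (lft x' y' z' t') (e₁ , e₂ , e₃) =
  outer x z x' z' e₁ , middle , outer y t y' t' e₃
  where
  outer : ∀ x z x' z' → x * (x' + z') ≡ x' * (x + z) → x * z' ≡ x' * z
  outer x z x' z' e = +-cancelˡ-≡ (x * x') (x * z') (x' * z) (begin
    x * x' + x * z'  ≡⟨ solve (x ∷ x' ∷ z' ∷ []) ⟩
    x * (x' + z')    ≡⟨ e ⟩
    x' * (x + z)     ≡⟨ solve (x ∷ x' ∷ z ∷ []) ⟩
    x * x' + x' * z  ∎)
  middle : x * t' + y * z' ≡ x' * t + y' * z
  middle = +-cancelˡ-≡ (x * y' + y * x') (x * t' + y * z') (x' * t + y' * z) (begin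
    x * y' + y * x' + (x * t' + y * z')  ≡⟨ solve (x ∷ y ∷ x' ∷ y' ∷ z' ∷ t' ∷ []) ⟩
    x * (y' + t') + y * (x' + z')        ≡⟨ e₂ ⟩
    x' * (y + t) + y' * (x + z)          ≡⟨ solve (x ∷ y ∷ z ∷ t ∷ x' ∷ y' ∷ []) ⟩
    x * y' + y * x' + (x' * t + y' * z)  ∎)

-- A right child is never a left child: the z² coefficients of w + 1 = w'/(w'+1),
-- cross-multiplied, force a(w) · (a(w') + c(w')) = 0, contradicting a ≠ 0.
rightChild≉leftChild : ∀ M N → Unimodular M → Unimodular N → ¬ (rightChild M ≈ leftChild N)
rightChild≉leftChild (lft x y z t) (lft x' y' z' t') uM uN (e₁ , _ , _)
  with m*n≡0⇒m≡0∨n≡0 x {x' + z'} product≡0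
  where
  product≡0 : x * (x' + z') ≡ 0
  product≡0 = m+n≡0⇒m≡0 (x * (x' + z')) (+-cancelˡ-≡ (x' * z) _ 0 (begin
    x' * z + (x * (x' + z') + z * z')  ≡⟨ solve (x ∷ z ∷ x' ∷ z' ∷ []) ⟩
    (x + z) * (x' + z')                ≡⟨ e₁ ⟩
    x' * z                             ≡⟨ sym (+-identityʳ (x' * z)) ⟩
    x' * z + 0                         ∎))
... | inj₁ x≡0     = a≢0 (lft x y z t) uM x≡0
... | inj₂ x'+z'≡0 = a≢0 (lft x' y' z' t') uN (m+n≡0⇒m≡0 x' x'+z'≡0)

z≉rightChild : ∀ M → Unimodular M → ¬ (idZ ≈ rightChild M)
z≉rightChild (lft x y z t) u (_ , _ , e₃) =
  d≢0 (lft x y z t) u (m+n≡0⇒n≡0 y (trans (sym (*-identityʳ (y + t))) (sym e₃)))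

z≉leftChild : ∀ M → Unimodular M → ¬ (idZ ≈ leftChild M)
z≉leftChild (lft x y z t) u (e₁ , _ , _) =
  a≢0 (lft x y z t) u (m+n≡0⇒m≡0 x (trans (sym (+-identityʳ (x + z))) (trans e₁ (*-zeroʳ x))))

eval-injective : ∀ v w → eval v ≈ eval w → v ≡ w
eval-injective []      []      _ = refl
eval-injective []      (L ∷ w) h = ⊥-elim (z≉leftChild (eval w) (eval-unimodular w) h)
eval-injective []      (R ∷ w) h = ⊥-elim (z≉rightChild (eval w) (eval-unimodular w) h)
eval-injective (L ∷ v) []      h = ⊥-elim (z≉leftChild (eval v) (eval-unimodular v) (≈-sym (eval (L ∷ v)) idZ h))
eval-injective (R ∷ v) []      h = ⊥-elim (z≉rightChild (eval v) (eval-unimodular v) (≈-sym (eval (R ∷ v)) idZ h))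
eval-injective (L ∷ v) (L ∷ w) h = cong (L ∷_) (eval-injective v w (leftChild-cancel (eval v) (eval w) h))
eval-injective (R ∷ v) (R ∷ w) h = cong (R ∷_) (eval-injective v w (rightChild-cancel (eval v) (eval w) h))
eval-injective (R ∷ v) (L ∷ w) h =
  ⊥-elim (rightChild≉leftChild (eval v) (eval w) (eval-unimodular v) (eval-unimodular w) h)
eval-injective (L ∷ v) (R ∷ w) h =
  ⊥-elim (rightChild≉leftChild (eval w) (eval v) (eval-unimodular w) (eval-unimodular v)
           (≈-sym (eval (L ∷ v)) (eval (R ∷ w)) h))

Form : LFT → ℕ → List ℕ → Set
Form f q qs = (length qs % 2 ≡ 0 × f ≈ cfPlusZ q qs) ⊎ (length qs % 2 ≡ 1 × f ≈ cfRecZ q qs)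

length%2 : ∀ qs → length qs % 2 ≡ (if evenLength qs then 0 else 1)
length%2 []           = refl
length%2 (_ ∷ [])     = refl
length%2 (_ ∷ _ ∷ qs) rewrite not-involutive (evenLength qs) = length%2 qs

canonical⇒Form : ∀ f q qs → f ≈ canonical q qs → Form f q qs
canonical⇒Form f q qs h with evenLength qs | length%2 qs
... | true  | k%2≡0 = inj₁ (k%2≡0 , h)
... | false | k%2≡1 = inj₂ (k%2≡1 , h)

Form⇒canonical : ∀ f q qs → Form f q qs → f ≈ canonical q qs
Form⇒canonical f q qs h with evenLength qs | length%2 qs | h
... | true  | _     | inj₁ (_ , f≈cf)  = f≈cf
... | false | _     | inj₂ (_ , f≈cf)  = f≈cf
... | true  | k%2≡0 | inj₂ (k%2≡1 , _) = ⊥-elim (0≢1+n (trans (sym k%2≡0) k%2≡1))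
... | false | k%2≡1 | inj₁ (k%2≡0 , _) = ⊥-elim (0≢1+n (trans (sym k%2≡0) k%2≡1))

≈-reflexive : ∀ {M N} → M ≡ N → M ≈ N
≈-reflexive {lft _ _ _ _} refl = refl , refl , refl

runs-Form : ∀ q qs → Form (eval (runs R q qs)) q qs
runs-Form q qs = canonical⇒Form (eval (runs R q qs)) q qs (≈-reflexive (eval-runs-R q qs))

Form⇒runs : ∀ f q qs → Form f q qs → f ≈ eval (runs R q qs)
Form⇒runs f q qs h = subst (f ≈_) (sym (eval-runs-R q qs)) (Form⇒canonical f q qs h)

mainTheorem9 : (n : ℕ) (f : LFT) → f ∈ row n →
    ∃[ q₀ ] ∃[ qs ]
      ( All (λ q → 1 ≤ q) qs
      × ( (length qs % 2 ≡ 0 × f ≈ cfPlusZ q₀ qs)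
        ⊎ (length qs % 2 ≡ 1 × f ≈ cfRecZ q₀ qs) )
      × ((q₀' : ℕ) (qs' : List ℕ) → All (λ q → 1 ≤ q) qs' →
          ( (length qs' % 2 ≡ 0 × f ≈ cfPlusZ q₀' qs')
          ⊎ (length qs' % 2 ≡ 1 × f ≈ cfRecZ q₀' qs') ) →
          (q₀' ≡ q₀ × qs' ≡ qs))
      × f ∈ row (q₀ + sum qs) )
mainTheorem9 n f f∈row with row-words n f∈row
... | w , _ , refl = q₀ , qs , rle-positive R w , existence , uniqueness , inRow
  where
  q₀ = proj₁ (rle R w)
  qs = proj₂ (rle R w)

  decode : runs R q₀ qs ≡ w
  decode = runs-rle R w

  existence : Form (eval w) q₀ qs
  existence = subst (λ v → Form (eval v) q₀ qs) decode (runs-Form q₀ qs)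

  -- Any admissible (q₀', qs') describes a word with the value of w, hence w itself.
  uniqueness : (q₀' : ℕ) (qs' : List ℕ) → Positive qs' → Form (eval w) q₀' qs' → q₀' ≡ q₀ × qs' ≡ qs
  uniqueness q₀' qs' pos form = cong proj₁ encoding , cong proj₂ encoding
    where
    same-word : w ≡ runs R q₀' qs'
    same-word = eval-injective w (runs R q₀' qs') (Form⇒runs (eval w) q₀' qs' form)
    encoding : (q₀' , qs') ≡ (q₀ , qs)
    encoding = trans (sym (rle-runs R q₀' pos)) (cong (rle R) (sym same-word))

  inRow : eval w ∈ row (q₀ + sum qs)
  inRow = subst (λ k → eval w ∈ row k) (trans (cong length (sym decode)) (length-runs R q₀ qs)) (eval∈row w)
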